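{- Let $\Gamma_1=(G,\varphi_1)$ and $\Gamma_2=(G,\varphi_2)$ be additive rational gain graphs on the same underlying graph $G$ (vertex set $\{1,\dots,\ell\}$, no loops), each with all circles of length $2$ unbalanced, such that $\langle\Gamma_1\rangle=\langle\Gamma_2\rangle$, i.e. $\Gamma_1$ and $\Gamma_2$ have exactly the same balanced circles. Then $\phi_3(\mathcal{A}(\Gamma_1))=\phi_3(\mathcal{A}(\Gamma_2))$.
   Context: A gain graph $\Gamma=(G,\varphi)$: finite graph $G$ with gain map $\varphi$ assigning a rational number to each oriented edge with $\varphi(\mathtt e^{ -1})=-\varphi(\mathtt e)$. A circle is balanced if the sum of gains along it (in one direction) is $0$; $\langle\Gamma\rangle=(G,\mathcal B(\Gamma))$ where $\mathcal B(\Gamma)$ is the set of balanced circles. The canonical complete lift representation $\mathcal{A}(\Gamma)$ is the central arrangement in $\mathbb C^{\ell+1}$ (coordinates $x_0,\dots,x_\ell$) consisting of $\{x_0=0\}$ and, for each edge $\mathtt e$ oriented from $i$ to $j$, the hyperplane $\{x_i-x_j+\varphi(\mathtt e)x_0=0\}$. Falk invariant: for a central arrangement with hyperplanes $H_0,\dots,H_n$, $H_i=\alpha_i^{ -1}(0)$, let $E$ be the exterior algebra over $\mathbb C$ on $e_0,\dots,e_n$ with graded pieces $E^p$, and $\partial$ the degree $-1$ derivation with $\partial e_i=1$. A subset $S$ is dependent if $\{\alpha_i:i\in S\}$ is linearly dependent. The Orlik–Solomon ideal $I$ is generated by $\partial e_S$ for $S$ dependent ($e_S$ the wedge of the $e_i$,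 $i\in S$, in increasing order), $I^p=I\cap E^p$, and $\phi_3=\dim\ker(E^1\otimes I^2\to E^3,\ a\otimes b\mapsto a\wedge b)$. -}

module Defs where

open import Data.Nat using (ℕ; zero; suc; _≤_)
open import Data.Bool using (Bool; true; false; if_then_else_; _∧_)
open import Data.Fin using (Fin; zero; suc; fromℕ; inject₁)
open import Data.Fin.Subset using (Subset; ∣_∣; ⁅_⁆; _∉_; _∈_)
open import Data.Vec using (Vec; []; _∷_)
open import Data.Rational using (ℚ; 0ℚ; 1ℚ; _+_; _*_; -_; _-_)
open import Data.Product using (_×_; Σ; ∃)
open import Relation.Binary.PropositionalEquality using (_≡_; _≢_)
open import Relation.Nullary using (¬_)

∑ : ∀ {n} → (Fin n → ℚ) → ℚ
∑ {zero}  f = 0ℚ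
∑ {suc n} f = f zero + ∑ (λ i → f (suc i))

∑S : ∀ {n} → (Subset n → ℚ) → ℚ
∑S {zero}  f = f []
∑S {suc n} f = ∑S (λ s → f (false ∷ s)) + ∑S (λ s → f (true ∷ s))

-- Underlying (multi)graph G on vertex set Fin ℓ with m edges;
-- edge e is oriented from (src e) to (tgt e); a gain map φ : Fin m → ℚ gives
-- the gain of e in that orientation (the reverse orientation has gain - φ e).

-- A circle: a closed walk v₀ e₀ v₁ … e_{k-1} v_k = v₀ with k ≥ 2,
-- pairwise distinct vertices v₀ … v_{k-1} and pairwise distinct edges.
-- fwd i says whether edge e i is traversed along its orientation.
record Circle {ℓ m : ℕ} (src tgt : Fin m → Fin ℓ) : Set where
  field
    k      : ℕ
    2≤k    : 2 ≤ k
    v      : Fin (suc k) → Fin ℓ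
    closed : v (fromℕ k) ≡ v zero
    e      : Fin k → Fin m
    fwd    : Fin k → Bool
    step   : ∀ i → if fwd i
                     then (src (e i) ≡ v (inject₁ i) × tgt (e i) ≡ v (suc i))
                     else (tgt (e i) ≡ v (inject₁ i) × src (e i) ≡ v (suc i))
    v-inj  : ∀ i j → v (inject₁ i) ≡ v (inject₁ j) → i ≡ j
    e-inj  : ∀ i j → e i ≡ e j → i ≡ j

gainSum : ∀ {ℓ m} {src tgt : Fin m → Fin ℓ} → (Fin m → ℚ) → Circle src tgt → ℚ
gainSum φ C = ∑ (λ i → if fwd i then φ (e i) else - φ (e i))
  where open Circle C

Balanced : ∀ {ℓ m} {src tgt : Fin m → Fin ℓ} → (Fin m → ℚ) → Circle src tgt → Set
Balanced φ C = gainSum φ C ≡ 0ℚ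

-- Canonical complete lift representation A(Γ): hyperplanes indexed by
-- Fin (suc m) (index 0 is x₀ = 0, index suc e is the hyperplane of edge e),
-- linear forms on ℚ^{ℓ+1} with coordinates x₀ = zero, x_i = suc (i-1).

finEq : ∀ {n} → Fin n → Fin n → Bool
finEq zero    zero    = true
finEq zero    (suc _) = false
finEq (suc _) zero    = false
finEq (suc i) (suc j) = finEq i j

δ : ∀ {n} → Fin n → Fin n → ℚ
δ i j = if finEq i j then 1ℚ else 0ℚ

liftForm : ∀ {ℓ m} → (src tgt : Fin m → Fin ℓ) → (Fin m → ℚ) →
           Fin (suc m) → Fin (suc ℓ) → ℚ
liftForm src tgt φ zero    x = δ zero x
liftForm src tgt φ (suc e) x =
  (δ (suc (src e)) x - δ (suc (tgt e)) x) + φ e * δ zero x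

Dependent : ∀ {N d} → (Fin N → Fin d → ℚ) → Subset N → Set
Dependent {N} α S =
  Σ (Fin N → ℚ) λ c →
    (∀ i → i ∉ S → c i ≡ 0ℚ) ×
    (∃ λ i → c i ≢ 0ℚ) ×
    (∀ x → ∑ (λ i → c i * α i x) ≡ 0ℚ)

-- Exterior algebra E on generators e_0 … e_{N-1}: an element is a function
-- Subset N → ℚ giving its coefficient on the basis monomial e_S.

Ext : ℕ → Set
Ext N = Subset N → ℚ

subEq : ∀ {n} → Subset n → Subset n → Bool
subEq []       []       = true
subEq (x ∷ s)  (y ∷ t)  = (if x then y else (if y then false else true)) ∧ subEq s t

eS : ∀ {N} → Subset N → Ext N
eS S U = if subEq S U then 1ℚ else 0ℚ

-- number of pairs (s,t), s ∈ S, t ∈ T, with t < s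
inv : ∀ {n} → Subset n → Subset n → ℕ
inv []      []      = 0
inv (x ∷ S) (y ∷ T) = (if y then ∣ S ∣ else 0) Data.Nat.+ inv S T

sgn : ℕ → ℚ
sgn zero    = 1ℚ
sgn (suc n) = - sgn n

wedgeCoef : ∀ {n} → Subset n → Subset n → Subset n → ℚ
wedgeCoef []      []      []      = 1ℚ
wedgeCoef (true  ∷ S) (true  ∷ T) (_ ∷ U) = 0ℚ
wedgeCoef (true  ∷ S) (false ∷ T) (true ∷ U) = wedgeCoef S T U
wedgeCoef (false ∷ S) (true  ∷ T) (true ∷ U) = wedgeCoef S T U
wedgeCoef (false ∷ S) (false ∷ T) (false ∷ U) = wedgeCoef S T U
wedgeCoef (true  ∷ S) (false ∷ T) (false ∷ U) = 0ℚ
wedgeCoef (false ∷ S) (true  ∷ T) (false ∷ U) = 0ℚ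
wedgeCoef (false ∷ S) (false ∷ T) (true ∷ U) = 0ℚ

wedgeBasis : ∀ {n} → Subset n → Subset n → Subset n → ℚ
wedgeBasis S T U = sgn (inv S T) * wedgeCoef S T U

_∧E_ : ∀ {N} → Ext N → Ext N → Ext N
(a ∧E b) U = ∑S (λ S → ∑S (λ T → (a S * b T) * wedgeBasis S T U))

-- ∂ e_S  (∂ e_{i₁}…e_{i_p} = Σ_k (-1)^{k-1} e_{i₁}…ê_{i_k}…e_{i_p})
dcoef : ∀ {n} → Subset n → Subset n → ℚ
dcoef []          []          = 0ℚ
dcoef (true  ∷ S) (false ∷ U) = eS S U
dcoef (true  ∷ S) (true  ∷ U) = - dcoef S U
dcoef (false ∷ S) (false ∷ U) = dcoef S U
dcoef (false ∷ S) (true  ∷ U) = 0ℚ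

∂e : ∀ {N} → Subset N → Ext N
∂e S = dcoef S

-- Orlik–Solomon ideal I: the ideal generated by ∂ e_S, S dependent, i.e.
-- finite ℚ-linear combinations of e_T ∧ ∂ e_S.
InOS : ∀ {N d} → (Fin N → Fin d → ℚ) → Ext N → Set
InOS {N} α a =
  Σ ℕ λ r → Σ (Fin r → ℚ) λ c → Σ (Fin r → Subset N) λ T →
  Σ (Fin r → Subset N) λ S →
    (∀ j → Dependent α (S j)) ×
    (∀ U → a U ≡ ∑ (λ j → c j * (eS (T j) ∧E ∂e (S j)) U))

InOSdeg : ∀ {N d} → (Fin N → Fin d → ℚ) → ℕ → Ext N → Set
InOSdeg α p a = InOS α a × (∀ U → ∣ U ∣ ≢ p → a U ≡ 0ℚ)

-- E^1 ⊗ I^2 is identified with (I^2)^N via  Σ_i e_i ⊗ b_i  ↦  (b_i)_i ;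
-- the multiplication map becomes (b_i)_i ↦ Σ_i e_i ∧ b_i.

Tens : ℕ → Set
Tens N = Fin N → Ext N

FalkKer : ∀ {N d} → (Fin N → Fin d → ℚ) → Tens N → Set
FalkKer {N} α b =
  (∀ i → InOSdeg α 2 (b i)) ×
  (∀ U → ∑ (λ i → (eS ⁅ i ⁆ ∧E b i) U) ≡ 0ℚ)

lin : ∀ {N r} → (Fin r → ℚ) → (Fin r → Tens N) → Tens N
lin c b i U = ∑ (λ j → c j * b j i U)

HasDim : ∀ {N} → (Tens N → Set) → ℕ → Set
HasDim {N} K r =
  Σ (Fin r → Tens N) λ b →
    (∀ j → K (b j)) ×
    (∀ (c : Fin r → ℚ) → (∀ i U → lin c b i U ≡ 0ℚ) → ∀ j → c j ≡ 0ℚ) ×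
    (∀ x → K x → Σ (Fin r → ℚ) λ c → ∀ i U → x i U ≡ lin c b i U)

Phi3 : ∀ {N d} → (Fin N → Fin d → ℚ) → ℕ → Set
Phi3 α r = HasDim (FalkKer α) r

-- φ₃ is computed from the Orlik–Solomon ideal, which only depends on which sets of hyperplanes are
-- dependent, so it suffices that A(Γ₁) and A(Γ₂) have the same dependent sets. A relation ∑ cᵢ αᵢ = 0
-- among the lifted forms is a flow g = (c_e)ₑ on G together with c₀ = - ∑ₑ φ(e) g(e). If H₀ belongs
-- to the set, any nontrivial flow on its edges gives a relation, whatever the gains. If not, one
-- needs a nontrivial flow of gain zero. Walking along edges of the support of such a flow f, each in
-- the direction of the sign of f, never gets stuck (conservation), so it closes a circle C in the support. If C is φ₂-balanced, its signed indicator χ_C is such a flow for φ₂;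
-- otherwise C is φ₁-unbalanced too, and φ₂(C) f - (φ₂ · f) χ_C is a nontrivial flow of φ₂-gain zero
-- supported inside the support of f.

module Submission where

open import Defs
open import Algebra.Bundles using (CommutativeRing)
open import Data.Bool using (Bool; true; false; if_then_else_)
open import Data.Fin as Fin using (Fin; zero; suc; toℕ; fromℕ; fromℕ<; inject₁)
import Data.Fin.Properties as Finₚ
open import Data.Fin.Subset using (Subset; _∉_)
open import Data.Fin.Subset.Properties using (_∈?_)
open import Data.Nat as ℕ using (ℕ; zero; suc; z≤n; s≤s; _∸_)
import Data.Nat.Properties as ℕₚ
open import Data.Product using (Σ; ∃; _×_; _,_; proj₁; proj₂)
open import Data.Rational using (ℚ; 0ℚ; 1ℚ; _+_; _*_; -_; _-_; _<_; _≤_; 1/_; ≢-nonZero)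
open import Data.Rational.Properties
open import Data.Rational.Solver using (module +-*-Solver)
open import Data.Sum using (_⊎_; inj₁; inj₂)
open import Data.Vec.Functional using (_∷_)
open import Function using (_∘_)
open import Function.Bundles using (_⇔_; mk⇔; Equivalence)
open import Relation.Binary.Definitions using (tri<; tri≈; tri>)
open import Relation.Binary.PropositionalEquality
open import Relation.Nullary using (¬_; Dec; yes; no; does; contradiction)
open import Relation.Nullary.Decidable using (¬?; _×-dec_)
open import Algebra.Properties.Semiring.Sum (CommutativeRing.semiring +-*-commutativeRing)
  using (sum; sum-cong-≗; sum-replicate-zero; *-distribˡ-sum; *-distribʳ-sum)
  renaming (∑-distrib-+ to sum-distrib-+; ∑-comm to sum-comm)

open +-*-Solver

∑≡sum : ∀ {n} (f : Fin n → ℚ) → ∑ f ≡ sum f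
∑≡sum {zero}  f = refl
∑≡sum {suc n} f = cong (f zero +_) (∑≡sum (f ∘ suc))

∑-cong : ∀ {n} {f g : Fin n → ℚ} → (∀ i → f i ≡ g i) → ∑ f ≡ ∑ g
∑-cong {f = f} {g} f≗g = trans (∑≡sum f) (trans (sum-cong-≗ f≗g) (sym (∑≡sum g)))

∑-zero : ∀ {n} {f : Fin n → ℚ} → (∀ i → f i ≡ 0ℚ) → ∑ f ≡ 0ℚ
∑-zero {n} f≗0 = trans (∑-cong f≗0) (trans (∑≡sum {n} (λ _ → 0ℚ)) (sum-replicate-zero n))

∑-distrib-+ : ∀ {n} (f g : Fin n → ℚ) → ∑ (λ i → f i + g i) ≡ ∑ f + ∑ g
∑-distrib-+ f g =
  trans (∑≡sum (λ i → f i + g i)) (trans (sum-distrib-+ f g) (sym (cong₂ _+_ (∑≡sum f) (∑≡sum g))))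

*-distribˡ-∑ : ∀ {n} a (f : Fin n → ℚ) → a * ∑ f ≡ ∑ (λ i → a * f i)
*-distribˡ-∑ a f = trans (cong (a *_) (∑≡sum f)) (trans (*-distribˡ-sum a f) (sym (∑≡sum (λ i → a * f i))))

*-distribʳ-∑ : ∀ {n} a (f : Fin n → ℚ) → ∑ f * a ≡ ∑ (λ i → f i * a)
*-distribʳ-∑ a f = trans (cong (_* a) (∑≡sum f)) (trans (*-distribʳ-sum a f) (sym (∑≡sum (λ i → f i * a))))

∑-comm : ∀ {n k} (h : Fin n → Fin k → ℚ) →
         ∑ (λ i → ∑ (λ j → h i j)) ≡ ∑ (λ j → ∑ (λ i → h i j))
∑-comm h = begin
  ∑ (λ i → ∑ (h i))                 ≡⟨ ∑≡sum² h ⟩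
  sum (λ i → sum (h i))             ≡⟨ sum-comm h ⟩
  sum (λ j → sum (λ i → h i j))     ≡⟨ sym (∑≡sum² (λ j i → h i j)) ⟩
  ∑ (λ j → ∑ (λ i → h i j))         ∎
  where
  open ≡-Reasoning
  ∑≡sum² : ∀ {n k} (h : Fin n → Fin k → ℚ) → ∑ (λ i → ∑ (h i)) ≡ sum (λ i → sum (h i))
  ∑≡sum² h = trans (∑≡sum (λ i → ∑ (h i))) (sum-cong-≗ (λ i → ∑≡sum (h i)))

∑-linear : ∀ {n} a b (f g d : Fin n → ℚ) →
           ∑ (λ i → (a * f i - b * g i) * d i) ≡ a * ∑ (λ i → f i * d i) - b * ∑ (λ i → g i * d i)
∑-linear a b f g d = begin
  ∑ (λ i → (a * f i - b * g i) * d i)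
    ≡⟨ ∑-cong (λ i → solve 5 (λ a b f g d → (a :* f :- b :* g) :* d := a :* (f :* d) :+ (:- b) :* (g :* d))
                              refl a b (f i) (g i) (d i)) ⟩
  ∑ (λ i → a * (f i * d i) + (- b) * (g i * d i))
    ≡⟨ ∑-distrib-+ (λ i → a * (f i * d i)) (λ i → (- b) * (g i * d i)) ⟩
  ∑ (λ i → a * (f i * d i)) + ∑ (λ i → (- b) * (g i * d i))
    ≡⟨ sym (cong₂ _+_ (*-distribˡ-∑ a (λ i → f i * d i)) (*-distribˡ-∑ (- b) (λ i → g i * d i))) ⟩
  a * ∑ (λ i → f i * d i) + (- b) * ∑ (λ i → g i * d i)
    ≡⟨ cong (a * ∑ (λ i → f i * d i) +_) (sym (neg-distribˡ-* b _)) ⟩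
  a * ∑ (λ i → f i * d i) - b * ∑ (λ i → g i * d i) ∎
  where open ≡-Reasoning

∑-single : ∀ {n} (a : Fin n) {f : Fin n → ℚ} → (∀ i → i ≢ a → f i ≡ 0ℚ) → ∑ f ≡ f a
∑-single zero    {f} f-off = trans (cong (f zero +_) (∑-zero (λ i → f-off (suc i) λ ()))) (+-identityʳ _)
∑-single (suc a) {f} f-off =
  trans (cong₂ _+_ (f-off zero λ ()) (∑-single a (λ i i≢a → f-off (suc i) (i≢a ∘ Finₚ.suc-injective))))
        (+-identityˡ _)

∑-telescope : ∀ {k} (g : Fin (suc k) → ℚ) → ∑ (λ t → g (inject₁ t) - g (suc t)) ≡ g zero - g (fromℕ k)
∑-telescope {zero}  g = sym (+-inverseʳ (g zero))
∑-telescope {suc k} g = trans (cong (g zero - g (suc zero) +_) (∑-telescope (g ∘ suc)))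
  (solve 3 (λ a b c → (a :- b) :+ (b :- c) := a :- c) refl (g zero) (g (suc zero)) (g (suc (fromℕ k))))

∑-nonpos : ∀ {n} (f : Fin n → ℚ) → (∀ i → f i ≤ 0ℚ) → ∑ f ≤ 0ℚ
∑-nonpos {zero}  f f≤0 = ≤-refl
∑-nonpos {suc n} f f≤0 = +-mono-≤ (f≤0 zero) (∑-nonpos (f ∘ suc) (f≤0 ∘ suc))

∑-neg : ∀ {n} (f : Fin n → ℚ) → (∀ i → f i ≤ 0ℚ) → ∀ a → f a < 0ℚ → ∑ f < 0ℚ
∑-neg f f≤0 zero    fa<0 = +-mono-<-≤ fa<0 (∑-nonpos (f ∘ suc) (f≤0 ∘ suc))
∑-neg f f≤0 (suc a) fa<0 = +-mono-≤-< (f≤0 zero) (∑-neg (f ∘ suc) (f≤0 ∘ suc) a fa<0)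

δ-refl : ∀ {n} (i : Fin n) → δ i i ≡ 1ℚ
δ-refl zero    = refl
δ-refl (suc i) = δ-refl i

δ-≢ : ∀ {n} {i j : Fin n} → i ≢ j → δ i j ≡ 0ℚ
δ-≢ {i = zero}  {zero}  i≢j = contradiction refl i≢j
δ-≢ {i = zero}  {suc j} i≢j = refl
δ-≢ {i = suc i} {zero}  i≢j = refl
δ-≢ {i = suc i} {suc j} i≢j = δ-≢ (i≢j ∘ cong suc)

∑-δ : ∀ {n} (a : Fin n) (g : Fin n → ℚ) → ∑ (λ i → δ a i * g i) ≡ g a
∑-δ a g = begin
  ∑ (λ i → δ a i * g i) ≡⟨ ∑-single a (λ i i≢a → trans (cong (_* g i) (δ-≢ (i≢a ∘ sym))) (*-zeroˡ (g i))) ⟩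
  δ a a * g a           ≡⟨ cong (_* g a) (δ-refl a) ⟩
  1ℚ * g a              ≡⟨ *-identityˡ (g a) ⟩
  g a                   ∎
  where open ≡-Reasoning

p≢0⇒p*q≡0⇒q≡0 : ∀ {p q} → p ≢ 0ℚ → p * q ≡ 0ℚ → q ≡ 0ℚ
p≢0⇒p*q≡0⇒q≡0 {p} {q} p≢0 pq≡0 = begin
  q              ≡⟨ sym (*-identityˡ q) ⟩
  1ℚ * q         ≡⟨ cong (_* q) (sym (*-inverseˡ p)) ⟩
  (1/ p) * p * q ≡⟨ *-assoc (1/ p) p q ⟩
  1/ p * (p * q) ≡⟨ cong (1/ p *_) pq≡0 ⟩
  1/ p * 0ℚ      ≡⟨ *-zeroʳ (1/ p) ⟩
  0ℚ             ∎
  where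
  open ≡-Reasoning
  instance _ = ≢-nonZero p≢0

sign : Bool → ℚ
sign true  = 1ℚ
sign false = - 1ℚ

sign≢0 : ∀ b → sign b ≢ 0ℚ
sign≢0 true  ()
sign≢0 false ()

sign-* : ∀ b p → sign b * p ≡ (if b then p else - p)
sign-* true  p = *-identityˡ p
sign-* false p = solve 1 (λ p → (:- con 1ℚ) :* p := :- p) refl p

module _ {N d : ℕ} {α₁ α₂ : Fin N → Fin d → ℚ} (dependent₁⇒₂ : ∀ S → Dependent α₁ S → Dependent α₂ S) where

  InOS-mono : ∀ a → InOS α₁ a → InOS α₂ a
  InOS-mono a (r , c , T , S , S-dependent , a≡) =
    r , c , T , S , (λ j → dependent₁⇒₂ (S j) (S-dependent j)) , a≡

  FalkKer-mono : ∀ b → FalkKer α₁ b → FalkKer α₂ b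
  FalkKer-mono b (b∈I² , b-ker) = (λ i → InOS-mono (b i) (proj₁ (b∈I² i)) , proj₂ (b∈I² i)) , b-ker

HasDim-cong : ∀ {N} {K₁ K₂ : Tens N → Set} → (∀ x → K₁ x → K₂ x) → (∀ x → K₂ x → K₁ x) →
              ∀ r → HasDim K₁ r ⇔ HasDim K₂ r
HasDim-cong K₁⊆K₂ K₂⊆K₁ r = mk⇔ (transport K₁⊆K₂ K₂⊆K₁) (transport K₂⊆K₁ K₁⊆K₂)
  where
  transport : ∀ {K K′ : Tens _ → Set} → (∀ x → K x → K′ x) → (∀ x → K′ x → K x) → HasDim K r → HasDim K′ r
  transport K⊆K′ K′⊆K (b , b∈K , b-independent , b-spans) =
    b , (λ j → K⊆K′ (b j) (b∈K j)) , b-independent , (λ x x∈K′ → b-spans x (K′⊆K x x∈K′))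

Phi3-cong : ∀ {N d} {α₁ α₂ : Fin N → Fin d → ℚ} →
            (∀ S → Dependent α₁ S → Dependent α₂ S) → (∀ S → Dependent α₂ S → Dependent α₁ S) →
            ∀ r → Phi3 α₁ r ⇔ Phi3 α₂ r
Phi3-cong dependent₁⇒₂ dependent₂⇒₁ = HasDim-cong (FalkKer-mono dependent₁⇒₂) (FalkKer-mono dependent₂⇒₁)

NoRepeatBelow : ∀ {A : Set} → (ℕ → A) → ℕ → Set
NoRepeatBelow w n = ∀ {a b} → a ℕ.< b → b ℕ.< n → w a ≢ w b

noRepeat⇒injective : ∀ {A : Set} {w : ℕ → A} {n} → NoRepeatBelow w n →
                     ∀ (a b : Fin n) → w (toℕ a) ≡ w (toℕ b) → a ≡ b
noRepeat⇒injective noRepeat a b eq with ℕₚ.<-cmp (toℕ a) (toℕ b)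
... | tri< a<b _ _ = contradiction eq (noRepeat a<b (Finₚ.toℕ<n b))
... | tri≈ _ a≡b _ = Finₚ.toℕ-injective a≡b
... | tri> _ _ b<a = contradiction (sym eq) (noRepeat b<a (Finₚ.toℕ<n a))

record SimpleLoop {ℓ} (w : ℕ → Fin ℓ) : Set where
  field
    start length : ℕ
    0<length     : 0 ℕ.< length
    closes       : w (start ℕ.+ length) ≡ w start
    noRepeat     : NoRepeatBelow (λ t → w (start ℕ.+ t)) length

module _ {ℓ} (w : ℕ → Fin ℓ) where

  private
    loopBefore : ∀ {n} → NoRepeatBelow w n → ∀ (a : Fin n) → w n ≡ w (toℕ a) → SimpleLoop w
    loopBefore {n} noRepeat a wn≡wa = record
      { start    = toℕ a
      ; length   = n ∸ toℕ a
      ; 0<length = ℕₚ.m<n⇒0<n∸m (Finₚ.toℕ<n a)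
      ; closes   = trans (cong w a+k≡n) wn≡wa
      ; noRepeat = λ {_} {j} i<j j<k → noRepeat (ℕₚ.+-monoʳ-< (toℕ a) i<j)
                                 (subst (toℕ a ℕ.+ j ℕ.<_) a+k≡n (ℕₚ.+-monoʳ-< (toℕ a) j<k))
      }
      where
      a+k≡n : toℕ a ℕ.+ (n ∸ toℕ a) ≡ n
      a+k≡n = ℕₚ.m+[n∸m]≡n (ℕₚ.<⇒≤ (Finₚ.toℕ<n a))

    noRepeatBelow-or-loop : ∀ n → NoRepeatBelow w n ⊎ SimpleLoop w
    noRepeatBelow-or-loop zero = inj₁ (λ _ ())
    noRepeatBelow-or-loop (suc n) with noRepeatBelow-or-loop n
    ... | inj₂ loop = inj₂ loop
    ... | inj₁ noRepeat with Finₚ.any? (λ (a : Fin n) → w n Fin.≟ w (toℕ a))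
    ...   | yes (a , wn≡wa) = inj₂ (loopBefore noRepeat a wn≡wa)
    ...   | no noEarlier = inj₁ extend
      where
      extend : NoRepeatBelow w (suc n)
      extend {a} a<b b<1+n with ℕₚ.m≤n⇒m<n∨m≡n (ℕₚ.≤-pred b<1+n)
      ... | inj₁ b<n  = noRepeat a<b b<n
      ... | inj₂ refl = λ wa≡wn → noEarlier (fromℕ< a<b ,
                          sym (trans (cong w (Finₚ.toℕ-fromℕ< a<b)) wa≡wn))

  simpleLoop : SimpleLoop w
  simpleLoop with noRepeatBelow-or-loop (suc ℓ)
  ... | inj₂ loop = loop
  ... | inj₁ noRepeat with Finₚ.pigeonhole (ℕₚ.n<1+n ℓ) (w ∘ toℕ)
  ...   | i , j , i<j , wi≡wj = contradiction wi≡wj (noRepeat i<j (Finₚ.toℕ<n j))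

tailAlong headAlong : ∀ {P : Set} {A : Set} → Dec P → A → A → A
tailAlong d s t = if does d then s else t
headAlong d s t = if does d then t else s

tailAlong≢headAlong : ∀ {P A : Set} (d : Dec P) {s t : A} → s ≢ t → tailAlong d s t ≢ headAlong d s t
tailAlong≢headAlong (yes _) s≢t = s≢t
tailAlong≢headAlong (no _)  s≢t = s≢t ∘ sym

along-step : ∀ {P A : Set} (d : Dec P) {s t a b : A} → tailAlong d s t ≡ a → headAlong d s t ≡ b →
             if does d then (s ≡ a × t ≡ b) else (t ≡ a × s ≡ b)
along-step (yes _) s≡a t≡b = s≡a , t≡b
along-step (no _)  t≡a s≡b = t≡a , s≡b

module _ {n : ℕ} {x : ℚ} where

  private
    x*[0-1] : x * (0ℚ - 1ℚ) ≡ - x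
    x*[0-1] = solve 1 (λ x → x :* (con 0ℚ :- con 1ℚ) := :- x) refl x
    x*[1-0] : x * (1ℚ - 0ℚ) ≡ x
    x*[1-0] = solve 1 (λ x → x :* (con 1ℚ :- con 0ℚ) := x) refl x
    x*[0-0] : x * (0ℚ - 0ℚ) ≡ 0ℚ
    x*[0-0] = solve 1 (λ x → x :* (con 0ℚ :- con 0ℚ) := con 0ℚ) refl x
    -x<0 : 0ℚ < x → - x < 0ℚ
    -x<0 = neg-antimono-<
    x<0 : x ≢ 0ℚ → ¬ 0ℚ < x → x < 0ℚ
    x<0 x≢0 x≯0 with <-cmp x 0ℚ
    ... | tri< neg _ _ = neg
    ... | tri≈ _ x≡0 _ = contradiction x≡0 x≢0
    ... | tri> _ _ x>0 = contradiction x>0 x≯0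

  boundaryTerm-nonpos : (d : Dec (0ℚ < x)) (s t v : Fin n) → ¬ (x ≢ 0ℚ × tailAlong d s t ≡ v) →
                        x * (δ s v - δ t v) ≤ 0ℚ
  boundaryTerm-nonpos d s t v notLeaving with x ≟ 0ℚ
  ... | yes refl = ≤-reflexive (*-zeroˡ (δ s v - δ t v))
  boundaryTerm-nonpos (yes x>0) s t v notLeaving | no x≢0
    rewrite δ-≢ (λ s≡v → notLeaving (x≢0 , s≡v)) with t Fin.≟ v
  ... | yes refl rewrite δ-refl t = <⇒≤ (subst (_< 0ℚ) (sym x*[0-1]) (-x<0 x>0))
  ... | no t≢v   rewrite δ-≢ t≢v  = ≤-reflexive x*[0-0]
  boundaryTerm-nonpos (no x≯0) s t v notLeaving | no x≢0
    rewrite δ-≢ (λ t≡v → notLeaving (x≢0 , t≡v)) with s Fin.≟ v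
  ... | yes refl rewrite δ-refl s = <⇒≤ (subst (_< 0ℚ) (sym x*[1-0]) (x<0 x≢0 x≯0))
  ... | no s≢v   rewrite δ-≢ s≢v  = ≤-reflexive x*[0-0]

  boundaryTerm-neg : (d : Dec (0ℚ < x)) (s t v : Fin n) → s ≢ t → x ≢ 0ℚ → headAlong d s t ≡ v →
                     x * (δ s v - δ t v) < 0ℚ
  boundaryTerm-neg (yes x>0) s t .t s≢t x≢0 refl rewrite δ-refl t | δ-≢ s≢t =
    subst (_< 0ℚ) (sym x*[0-1]) (-x<0 x>0)
  boundaryTerm-neg (no x≯0) s t .s s≢t x≢0 refl rewrite δ-refl s | δ-≢ (s≢t ∘ sym) =
    subst (_< 0ℚ) (sym x*[1-0]) (x<0 x≢0 x≯0)

module GainGraph {ℓ m : ℕ} (src tgt : Fin m → Fin ℓ) where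

  incidence : Fin m → Fin ℓ → ℚ
  incidence e y = δ (src e) y - δ (tgt e) y

  boundary : (Fin m → ℚ) → Fin ℓ → ℚ
  boundary f y = ∑ (λ e → f e * incidence e y)

  IsFlow : (Fin m → ℚ) → Set
  IsFlow f = ∀ y → boundary f y ≡ 0ℚ

  gain : (Fin m → ℚ) → (Fin m → ℚ) → ℚ
  gain φ f = ∑ (λ e → f e * φ e)

  Nontrivial : (Fin m → ℚ) → Set
  Nontrivial f = ∃ λ e → f e ≢ 0ℚ

  _⊆supp_ : (Fin m → ℚ) → (Fin m → ℚ) → Set
  g ⊆supp f = ∀ e → f e ≡ 0ℚ → g e ≡ 0ℚ

  gain≢0⇒nontrivial : ∀ φ f → gain φ f ≢ 0ℚ → Nontrivial f
  gain≢0⇒nontrivial φ f gain≢0 = Finₚ.¬∀⟶∃¬ m (λ e → f e ≡ 0ℚ) (λ e → f e ≟ 0ℚ) λ f≡0 →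
    gain≢0 (∑-zero (λ e → trans (cong (_* φ e) (f≡0 e)) (*-zeroˡ (φ e))))

  combination-isFlow : ∀ a b {f g} → IsFlow f → IsFlow g → IsFlow (λ e → a * f e - b * g e)
  combination-isFlow a b {f} {g} f-flow g-flow y = begin
    boundary (λ e → a * f e - b * g e) y      ≡⟨ ∑-linear a b f g (λ e → incidence e y) ⟩
    a * boundary f y - b * boundary g y       ≡⟨ cong₂ (λ p q → a * p - b * q) (f-flow y) (g-flow y) ⟩
    a * 0ℚ - b * 0ℚ                           ≡⟨ solve 2 (λ a b → a :* con 0ℚ :- b :* con 0ℚ := con 0ℚ) refl a b ⟩
    0ℚ                                        ∎
    where open ≡-Reasoning

  liftCombination-x₀ : ∀ φ (c : Fin (suc m) → ℚ) →
                       ∑ (λ i → c i * liftForm src tgt φ i zero) ≡ c zero + gain φ (c ∘ suc)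
  liftCombination-x₀ φ c = cong₂ _+_ (*-identityʳ (c zero)) (∑-cong (λ e →
    solve 2 (λ a p → a :* ((con 0ℚ :- con 0ℚ) :+ p :* con 1ℚ) := a :* p) refl (c (suc e)) (φ e)))

  liftCombination-xᵢ : ∀ φ (c : Fin (suc m) → ℚ) y →
                       ∑ (λ i → c i * liftForm src tgt φ i (suc y)) ≡ boundary (c ∘ suc) y
  liftCombination-xᵢ φ c y = trans (cong₂ _+_ (*-zeroʳ (c zero)) (∑-cong (λ e →
    solve 3 (λ a p d → a :* (d :+ p :* con 0ℚ) := a :* d) refl (c (suc e)) (φ e) (incidence e y))))
    (+-identityˡ _)

  liftRelation⇔ : ∀ φ (c : Fin (suc m) → ℚ) →
                  (∀ x → ∑ (λ i → c i * liftForm src tgt φ i x) ≡ 0ℚ) ⇔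
                  (c zero + gain φ (c ∘ suc) ≡ 0ℚ × IsFlow (c ∘ suc))
  liftRelation⇔ φ c = mk⇔
    (λ rel → trans (sym (liftCombination-x₀ φ c)) (rel zero) ,
             λ y → trans (sym (liftCombination-xᵢ φ c y)) (rel (suc y)))
    (λ { (rel₀ , flow) zero    → trans (liftCombination-x₀ φ c) rel₀
       ; (rel₀ , flow) (suc y) → trans (liftCombination-xᵢ φ c y) (flow y) })

  module _ (C : Circle src tgt) where
    open Circle C

    χ : Fin m → ℚ
    χ x = ∑ (λ t → sign (fwd t) * δ (e t) x)

    ∑-χ : ∀ (h : Fin m → ℚ) → ∑ (λ x → χ x * h x) ≡ ∑ (λ t → sign (fwd t) * h (e t))
    ∑-χ h = begin
      ∑ (λ x → χ x * h x)
        ≡⟨ ∑-cong (λ x → *-distribʳ-∑ (h x) (λ t → sign (fwd t) * δ (e t) x)) ⟩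
      ∑ (λ x → ∑ (λ t → sign (fwd t) * δ (e t) x * h x))
        ≡⟨ ∑-comm (λ x t → sign (fwd t) * δ (e t) x * h x) ⟩
      ∑ (λ t → ∑ (λ x → sign (fwd t) * δ (e t) x * h x))
        ≡⟨ ∑-cong (λ t → ∑-cong (λ x →
             solve 3 (λ s d h → s :* d :* h := d :* (s :* h)) refl (sign (fwd t)) (δ (e t) x) (h x))) ⟩
      ∑ (λ t → ∑ (λ x → δ (e t) x * (sign (fwd t) * h x)))
        ≡⟨ ∑-cong (λ t → ∑-δ (e t) (λ x → sign (fwd t) * h x)) ⟩
      ∑ (λ t → sign (fwd t) * h (e t)) ∎
      where open ≡-Reasoning

    gain-χ : ∀ φ → gain φ χ ≡ gainSum φ C
    gain-χ φ = trans (∑-χ φ) (∑-cong (λ t → sign-* (fwd t) (φ (e t))))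

    χ-isFlow : IsFlow χ
    χ-isFlow y = begin
      ∑ (λ x → χ x * incidence x y)                    ≡⟨ ∑-χ (λ x → incidence x y) ⟩
      ∑ (λ t → sign (fwd t) * incidence (e t) y)       ≡⟨ ∑-cong (λ t → sign-incidence (fwd t) (step t)) ⟩
      ∑ (λ t → δ (v (inject₁ t)) y - δ (v (suc t)) y)  ≡⟨ ∑-telescope (λ i → δ (v i) y) ⟩
      δ (v zero) y - δ (v (fromℕ k)) y                 ≡⟨ cong (λ u → δ (v zero) y - δ u y) closed ⟩
      δ (v zero) y - δ (v zero) y                      ≡⟨ +-inverseʳ (δ (v zero) y) ⟩
      0ℚ                                               ∎
      where
      open ≡-Reasoning
      sign-incidence : ∀ b {x a c} → (if b then (src x ≡ a × tgt x ≡ c) else (tgt x ≡ a × src x ≡ c)) →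
                       sign b * incidence x y ≡ δ a y - δ c y
      sign-incidence true  (refl , refl) = *-identityˡ _
      sign-incidence false {x} (refl , refl) =
        solve 2 (λ p q → (:- con 1ℚ) :* (p :- q) := q :- p) refl (δ (src x) y) (δ (tgt x) y)

    χ-onCircle : ∀ t → χ (e t) ≡ sign (fwd t)
    χ-onCircle t = begin
      χ (e t)                       ≡⟨ ∑-single t (λ u u≢t → trans (cong (sign (fwd u) *_) (δ-≢ (u≢t ∘ e-inj u t)))
                                                                   (*-zeroʳ (sign (fwd u)))) ⟩
      sign (fwd t) * δ (e t) (e t)  ≡⟨ cong (sign (fwd t) *_) (δ-refl (e t)) ⟩
      sign (fwd t) * 1ℚ             ≡⟨ *-identityʳ (sign (fwd t)) ⟩
      sign (fwd t)                  ∎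
      where open ≡-Reasoning

    χ-offCircle : ∀ x → (∀ t → e t ≢ x) → χ x ≡ 0ℚ
    χ-offCircle x notOnC =
      ∑-zero (λ t → trans (cong (sign (fwd t) *_) (δ-≢ (notOnC t))) (*-zeroʳ (sign (fwd t))))

    χ-nontrivial : Nontrivial χ
    χ-nontrivial = e t₀ , λ χ≡0 → sign≢0 (fwd t₀) (trans (sym (χ-onCircle t₀)) χ≡0)
      where
      t₀ : Fin k
      t₀ = fromℕ< (ℕₚ.<-≤-trans (s≤s z≤n) 2≤k)

    χ-⊆supp : ∀ {f} → (∀ t → f (e t) ≢ 0ℚ) → χ ⊆supp f
    χ-⊆supp onSupp x fx≡0 = χ-offCircle x (λ t et≡x → onSupp t (trans (cong _ et≡x) fx≡0))

  module _ (loopless : ∀ e → src e ≢ tgt e) {f : Fin m → ℚ} (f-isFlow : IsFlow f) where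

    tl hd : Fin m → Fin ℓ
    tl e = tailAlong (0ℚ <? f e) (src e) (tgt e)
    hd e = headAlong (0ℚ <? f e) (src e) (tgt e)

    SupportEdge : Set
    SupportEdge = Σ (Fin m) λ e → f e ≢ 0ℚ

    -- If no support edge left hd e, every term of boundary f (hd e) would be ≤ 0 and the term of e < 0.
    flow-continues : ((e , _) : SupportEdge) → Σ SupportEdge λ (e′ , _) → tl e′ ≡ hd e
    flow-continues (e , fe≢0) with Finₚ.any? (λ e′ → ¬? (f e′ ≟ 0ℚ) ×-dec (tl e′ Fin.≟ hd e))
    ... | yes (e′ , fe′≢0 , leaving) = (e′ , fe′≢0) , leaving
    ... | no noneLeaving = contradiction (f-isFlow (hd e)) (<⇒≢ (∑-neg _ nonpos e neg))
      where
      nonpos : ∀ e′ → f e′ * incidence e′ (hd e) ≤ 0ℚ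
      nonpos e′ = boundaryTerm-nonpos (0ℚ <? f e′) (src e′) (tgt e′) (hd e)
                                      (λ leaving → noneLeaving (e′ , leaving))
      neg : f e * incidence e (hd e) < 0ℚ
      neg = boundaryTerm-neg (0ℚ <? f e) (src e) (tgt e) (hd e) (loopless e) fe≢0 refl

    module _ (start : SupportEdge) where

      private
        trail : ℕ → SupportEdge
        trail zero    = start
        trail (suc n) = proj₁ (flow-continues (trail n))

        edge : ℕ → Fin m
        edge = proj₁ ∘ trail

        vertex : ℕ → Fin ℓ
        vertex = tl ∘ edge

        edge-hd : ∀ n → hd (edge n) ≡ vertex (suc n)
        edge-hd n = sym (proj₂ (flow-continues (trail n)))

        open SimpleLoop (simpleLoop vertex) renaming (start to i; length to k)

        u : ℕ → Fin ℓ
        u t = vertex (i ℕ.+ t)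

        k≢1 : k ≢ 1
        k≢1 k≡1 = tailAlong≢headAlong (0ℚ <? f (edge i)) (loopless (edge i)) (begin
          vertex i             ≡⟨ sym closes ⟩
          vertex (i ℕ.+ k)     ≡⟨ cong u k≡1 ⟩
          vertex (i ℕ.+ 1)     ≡⟨ cong vertex (ℕₚ.+-comm i 1) ⟩
          vertex (suc i)       ≡⟨ sym (edge-hd i) ⟩
          hd (edge i)          ∎)
          where open ≡-Reasoning

        u-injective : ∀ (a b : Fin k) → u (toℕ a) ≡ u (toℕ b) → a ≡ b
        u-injective = noRepeat⇒injective {w = u} noRepeat

        u-inject₁ : ∀ (t : Fin k) → u (toℕ t) ≡ u (toℕ (inject₁ t))
        u-inject₁ t = cong u (sym (Finₚ.toℕ-inject₁ t))

      supportCircle : Circle src tgt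
      supportCircle = record
        { k      = k
        ; 2≤k    = ℕₚ.≤∧≢⇒< 0<length (k≢1 ∘ sym)
        ; v      = u ∘ toℕ
        ; closed = trans (cong u (Finₚ.toℕ-fromℕ k)) (trans closes (cong vertex (sym (ℕₚ.+-identityʳ i))))
        ; e      = λ t → edge (i ℕ.+ toℕ t)
        ; fwd    = λ t → does (0ℚ <? f (edge (i ℕ.+ toℕ t)))
        ; step   = λ t → along-step (0ℚ <? f (edge (i ℕ.+ toℕ t))) (u-inject₁ t)
                           (trans (edge-hd (i ℕ.+ toℕ t)) (cong vertex (sym (ℕₚ.+-suc i (toℕ t)))))
        ; v-inj  = λ a b eq → u-injective a b (trans (u-inject₁ a) (trans eq (sym (u-inject₁ b))))
        ; e-inj  = λ a b eq → u-injective a b (cong tl eq)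
        }

      supportCircle-onSupport : ∀ t → f (Circle.e supportCircle t) ≢ 0ℚ
      supportCircle-onSupport t = proj₂ (trail (i ℕ.+ toℕ t))

  ZeroGainFlowWithin : (Fin m → ℚ) → (Fin m → ℚ) → Set
  ZeroGainFlowWithin φ f = Σ (Fin m → ℚ) λ g → IsFlow g × gain φ g ≡ 0ℚ × g ⊆supp f × Nontrivial g

  -- The witness A f - B h, with A = gain φ₂ h and B = gain φ₂ f, has φ₂-gain A B - B A = 0; it is
  -- nontrivial since for B = 0 it is A f, while otherwise its φ₁-gain is - B (gain φ₁ h) ≢ 0.
  eliminateGain : ∀ {φ₁ φ₂ f h} → IsFlow f → IsFlow h → gain φ₁ f ≡ 0ℚ → gain φ₁ h ≢ 0ℚ →
                  gain φ₂ h ≢ 0ℚ → h ⊆supp f → Nontrivial f → ZeroGainFlowWithin φ₂ f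
  eliminateGain {φ₁} {φ₂} {f} {h} f-flow h-flow gain₁f≡0 gain₁h≢0 A≢0 h⊆f (e , fe≢0) =
    g , combination-isFlow A B f-flow h-flow , gain₂g≡0 , g⊆f , g-nontrivial
    where
    A = gain φ₂ h
    B = gain φ₂ f
    g : Fin m → ℚ
    g x = A * f x - B * h x

    gain₂g≡0 : gain φ₂ g ≡ 0ℚ
    gain₂g≡0 = trans (∑-linear A B f h φ₂) (solve 2 (λ A B → A :* B :- B :* A := con 0ℚ) refl A B)

    g⊆f : g ⊆supp f
    g⊆f x fx≡0 = trans (cong₂ (λ p q → A * p - B * q) fx≡0 (h⊆f x fx≡0))
                       (solve 2 (λ A B → A :* con 0ℚ :- B :* con 0ℚ := con 0ℚ) refl A B)

    gain₁g : gain φ₁ g ≡ - (B * gain φ₁ h)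
    gain₁g = trans (∑-linear A B f h φ₁) (trans (cong (λ p → A * p - B * gain φ₁ h) gain₁f≡0)
      (solve 3 (λ A B G → A :* con 0ℚ :- B :* G := :- (B :* G)) refl A B (gain φ₁ h)))

    g-nontrivial : Nontrivial g
    g-nontrivial with B ≟ 0ℚ
    ... | yes B≡0 = e , λ ge≡0 → fe≢0 (p≢0⇒p*q≡0⇒q≡0 A≢0 (begin
      A * f e             ≡⟨ solve 3 (λ A f h → A :* f := A :* f :- con 0ℚ :* h) refl A (f e) (h e) ⟩
      A * f e - 0ℚ * h e  ≡⟨ cong (λ b → A * f e - b * h e) (sym B≡0) ⟩
      g e                 ≡⟨ ge≡0 ⟩
      0ℚ                  ∎))
      where open ≡-Reasoning
    ... | no B≢0 = gain≢0⇒nontrivial φ₁ g λ gain₁g≡0 → gain₁h≢0 (p≢0⇒p*q≡0⇒q≡0 B≢0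
      (neg-injective (trans (sym gain₁g) gain₁g≡0)))

  LiftRelationOn : (Fin m → ℚ) → Subset (suc m) → Set
  LiftRelationOn φ S = Σ ℚ λ a → Σ (Fin m → ℚ) λ g →
    (zero ∉ S → a ≡ 0ℚ) × (∀ e → suc e ∉ S → g e ≡ 0ℚ) × a + gain φ g ≡ 0ℚ × IsFlow g × Nontrivial g

  liftDependent⇔ : ∀ φ S → Dependent (liftForm src tgt φ) S ⇔ LiftRelationOn φ S
  liftDependent⇔ φ S = mk⇔ to from
    where
    to : Dependent (liftForm src tgt φ) S → LiftRelationOn φ S
    to (c , c-supp , (i , cᵢ≢0) , rel) =
      c zero , c ∘ suc , c-supp zero , c-supp ∘ suc , rel₀ , flow , nontrivial i cᵢ≢0
      where
      rel₀ = proj₁ (Equivalence.to (liftRelation⇔ φ c) rel)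
      flow = proj₂ (Equivalence.to (liftRelation⇔ φ c) rel)
      nontrivial : ∀ i → c i ≢ 0ℚ → Nontrivial (c ∘ suc)
      nontrivial (suc e) cₑ≢0 = e , cₑ≢0
      nontrivial zero    c₀≢0 = gain≢0⇒nontrivial φ (c ∘ suc) λ gain≡0 →
        c₀≢0 (trans (sym (+-identityʳ (c zero))) (trans (cong (c zero +_) (sym gain≡0)) rel₀))

    from : LiftRelationOn φ S → Dependent (liftForm src tgt φ) S
    from (a , g , a-supp , g-supp , rel₀ , flow , (e , gₑ≢0)) =
      a ∷ g , supp , (suc e , gₑ≢0) , Equivalence.from (liftRelation⇔ φ (a ∷ g)) (rel₀ , flow)
      where
      supp : ∀ i → i ∉ S → (a ∷ g) i ≡ 0ℚ
      supp zero    = a-supp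
      supp (suc e) = g-supp e

  module _ (loopless : ∀ e → src e ≢ tgt e) {φ₁ φ₂ : Fin m → ℚ}
           (balanced₁⇒₂ : ∀ (C : Circle src tgt) → Balanced φ₁ C → Balanced φ₂ C) where

    zeroGainFlow-transfer : ∀ {f} → IsFlow f → gain φ₁ f ≡ 0ℚ → Nontrivial f → ZeroGainFlowWithin φ₂ f
    zeroGainFlow-transfer {f} f-flow gain₁f≡0 f-nontrivial =
      transferVia (supportCircle loopless f-flow f-nontrivial)
                  (supportCircle-onSupport loopless f-flow f-nontrivial)
      where
      transferVia : (C : Circle src tgt) → (∀ t → f (Circle.e C t) ≢ 0ℚ) → ZeroGainFlowWithin φ₂ f
      transferVia C C⊆f with gainSum φ₂ C ≟ 0ℚ
      ... | yes C-balanced₂ =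
        χ C , χ-isFlow C , trans (gain-χ C φ₂) C-balanced₂ , χ-⊆supp C C⊆f , χ-nontrivial C
      ... | no C-unbalanced₂ =
        eliminateGain {φ₁} f-flow (χ-isFlow C) gain₁f≡0
          (λ gain₁χ≡0 → C-unbalanced₂ (balanced₁⇒₂ C (trans (sym (gain-χ C φ₁)) gain₁χ≡0)))
          (λ gain₂χ≡0 → C-unbalanced₂ (trans (sym (gain-χ C φ₂)) gain₂χ≡0))
          (χ-⊆supp C C⊆f) f-nontrivial


    liftRelationOn-transfer : ∀ {S} → LiftRelationOn φ₁ S → LiftRelationOn φ₂ S
    liftRelationOn-transfer {S} (a , g , a-supp , g-supp , rel₀ , g-flow , g-nontrivial) with zero ∈? S
    ... | yes 0∈S =
      - gain φ₂ g , g , contradiction 0∈S , g-supp , +-inverseˡ (gain φ₂ g) , g-flow , g-nontrivial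
    ... | no 0∉S  = zeroGainRelation (zeroGainFlow-transfer g-flow gain₁g≡0 g-nontrivial)
      where
      gain₁g≡0 : gain φ₁ g ≡ 0ℚ
      gain₁g≡0 = trans (sym (+-identityˡ (gain φ₁ g))) (trans (cong (_+ gain φ₁ g) (sym (a-supp 0∉S))) rel₀)
      zeroGainRelation : ZeroGainFlowWithin φ₂ g → LiftRelationOn φ₂ S
      zeroGainRelation (g′ , g′-flow , gain₂g′≡0 , g′⊆g , g′-nontrivial) =
        0ℚ , g′ , (λ _ → refl) , (λ e e∉S → g′⊆g e (g-supp e e∉S)) ,
        trans (+-identityˡ (gain φ₂ g′)) gain₂g′≡0 , g′-flow , g′-nontrivial

    liftDependent-transfer : ∀ S → Dependent (liftForm src tgt φ₁) S → Dependent (liftForm src tgt φ₂) S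
    liftDependent-transfer S =
      Equivalence.from (liftDependent⇔ φ₂ S) ∘ liftRelationOn-transfer ∘ Equivalence.to (liftDependent⇔ φ₁ S)

proposition3p9 : (ℓ m : ℕ) (src tgt : Fin m → Fin ℓ) (φ₁ φ₂ : Fin m → ℚ) →
    (∀ e → src e ≢ tgt e) →
    (∀ (C : Circle src tgt) → Circle.k C ≡ 2 → ¬ Balanced φ₁ C) →
    (∀ (C : Circle src tgt) → Circle.k C ≡ 2 → ¬ Balanced φ₂ C) →
    (∀ (C : Circle src tgt) → Balanced φ₁ C ⇔ Balanced φ₂ C) →
    ∀ r → Phi3 (liftForm src tgt φ₁) r ⇔ Phi3 (liftForm src tgt φ₂) r
proposition3p9 ℓ m src tgt φ₁ φ₂ loopless _ _ balanced⇔ =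
  Phi3-cong {α₁ = liftForm src tgt φ₁} {α₂ = liftForm src tgt φ₂}
            (liftDependent-transfer loopless {φ₁} {φ₂} (Equivalence.to ∘ balanced⇔))
            (liftDependent-transfer loopless {φ₂} {φ₁} (Equivalence.from ∘ balanced⇔))
  where open GainGraph src tgt
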